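{- If $G$ is a connected graph, then ${\rm gp_{e}}(G) \le 2\cdot{\rm ip_e}(G)$.
   Context: All graphs are finite and simple. A geodesic (isometric path) of $G$ is a shortest path between two vertices of $G$. A set $S$ of edges of $G$ is an edge general position set if no geodesic of $G$ contains three edges of $S$; ${\rm gp_{e}}(G)$ is the maximum cardinality of an edge general position set of $G$. An isometric path edge cover of $G$ is a collection $\mathcal{P}$ of geodesics of $G$ such that every edge of $G$ lies on at least one path of $\mathcal{P}$; ${\rm ip_e}(G)$ is the minimum cardinality of an isometric path edge cover of $G$. -}

module Defs where

open import Data.Nat using (ℕ; zero; suc; _≤_)
open import Data.Fin using (Fin; _<_)
open import Data.Bool using (Bool; true; false)
open import Data.Product using (Σ; ∃; _×_; _,_; proj₁; proj₂)
open import Data.Sum using (_⊎_)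
open import Data.List using (List)
open import Data.List.Membership.Propositional using (_∈_)
open import Data.List.Relation.Unary.All using (All)
open import Data.List.Relation.Unary.Any using (Any)
open import Data.List.Relation.Unary.Unique.Propositional using (Unique)
open import Relation.Binary.PropositionalEquality using (_≡_; _≢_)
open import Relation.Nullary using (¬_)

record Graph (n : ℕ) : Set where
  field
    adj     : Fin n → Fin n → Bool
    symm    : ∀ u v → adj u v ≡ adj v u
    irrefl  : ∀ u → adj u u ≡ false

open Graph public

module _ {n : ℕ} (G : Graph n) where

  data Walk : Fin n → Fin n → ℕ → Set where
    [_]  : (u : Fin n) → Walk u u 0
    _∷_  : ∀ {u w v k} → adj G u w ≡ true → Walk w v k → Walk u v (suc k)

  Connected : Set
  Connected = ∀ u v → ∃ λ k → Walk u v k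

  -- a geodesic: a walk that is a shortest walk between its endpoints
  -- (shortest walks are automatically paths)
  IsGeodesic : ∀ {u v k} → Walk u v k → Set
  IsGeodesic {u} {v} {k} _ = ∀ {m} → Walk u v m → k ≤ m

  record Geodesic : Set where
    constructor geodesic
    field
      start end : Fin n
      len       : ℕ
      walk      : Walk start end len
      isGeo     : IsGeodesic walk

  -- edges are represented canonically as pairs (a , b) with a < b
  Edge : Set
  Edge = Fin n × Fin n

  IsEdge : Edge → Set
  IsEdge (a , b) = (a < b) × (adj G a b ≡ true)

  data OnWalk (a b : Fin n) : ∀ {u v k} → Walk u v k → Set where
    here  : ∀ {u w v k} (e : adj G u w ≡ true) (p : Walk w v k) →
            ((u ≡ a × w ≡ b) ⊎ (u ≡ b × w ≡ a)) → OnWalk a b (e ∷ p)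
    there : ∀ {u w v k} (e : adj G u w ≡ true) (p : Walk w v k) →
            OnWalk a b p → OnWalk a b (e ∷ p)

  OnGeodesic : Edge → Geodesic → Set
  OnGeodesic (a , b) P = OnWalk a b (Geodesic.walk P)

  IsEdgeSet : List Edge → Set
  IsEdgeSet S = All IsEdge S × Unique S

  IsEdgeGPSet : List Edge → Set
  IsEdgeGPSet S = IsEdgeSet S ×
    (∀ (P : Geodesic) (e₁ e₂ e₃ : Edge) →
       e₁ ∈ S → e₂ ∈ S → e₃ ∈ S →
       e₁ ≢ e₂ → e₁ ≢ e₃ → e₂ ≢ e₃ →
       ¬ (OnGeodesic e₁ P × OnGeodesic e₂ P × OnGeodesic e₃ P))

  IsIsoPathEdgeCover : List Geodesic → Set
  IsIsoPathEdgeCover 𝒫 = ∀ (e : Edge) → IsEdge e → Any (OnGeodesic e) 𝒫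

{-# OPTIONS --safe #-}
module Submission where

-- A geodesic carries at most two edges of an edge general position set S, and
-- every edge of S lies on some geodesic of the cover; double counting the
-- incidences between S and the cover gives |S| ≤ 2 |𝒫|.

open import Defs
open import Data.Nat using (ℕ; suc; _≤_; _*_; _+_; z≤n; s≤s)
open import Data.Nat.Properties using (*-suc; +-suc; +-mono-≤; module ≤-Reasoning)
open import Data.List using (List; []; _∷_; length; filter)
open import Data.List.Relation.Binary.Subset.Propositional using (_⊆_)
open import Data.List.Relation.Binary.Subset.Propositional.Properties using (⊆-trans; filter-⊆)
open import Data.List.Relation.Unary.All as All using (All; _∷_)
open import Data.List.Relation.Unary.All.Properties using (all-filter) renaming (filter⁺ to All-filter⁺)
open import Data.List.Relation.Unary.Any using (Any; here; there)
open import Data.List.Relation.Unary.AllPairs.Core using (_∷_)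
open import Data.List.Relation.Unary.Unique.Propositional using (Unique)
open import Data.List.Relation.Unary.Unique.Propositional.Properties using () renaming (filter⁺ to Unique-filter⁺)
open import Data.Fin using (Fin)
open import Data.Fin.Properties using (_≟_)
open import Data.Product using (_,_)
open import Data.Empty using (⊥-elim)
open import Relation.Binary.PropositionalEquality using (_≡_; refl; cong; sym; trans)
open import Relation.Nullary using (¬_; Dec; yes; no; _×-dec_; _⊎-dec_)
open import Relation.Unary using (Pred; Decidable)
open import Relation.Unary.Properties using (∁?)

length-filter-∁ : ∀ {a p} {A : Set a} {P : Pred A p} (P? : Decidable P) (xs : List A) →
                  length xs ≡ length (filter P? xs) + length (filter (∁? P?) xs)
length-filter-∁ P? []       = refl
length-filter-∁ P? (x ∷ xs) with P? x
... | yes _ = cong suc (length-filter-∁ P? xs)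
... | no  _ = trans (cong suc (length-filter-∁ P? xs)) (sym (+-suc (length (filter P? xs)) _))

any-∷-∁ : ∀ {ℓ p} {B : Set ℓ} {P : Pred B p} {b bs} → Any P (b ∷ bs) → ¬ P b → Any P bs
any-∷-∁ (here pb)   ¬pb = ⊥-elim (¬pb pb)
any-∷-∁ (there pbs) _   = pbs

module _ {ℓ₁ ℓ₂ ℓ₃} {A : Set ℓ₁} {B : Set ℓ₂} (R : A → B → Set ℓ₃) (R? : ∀ x b → Dec (R x b)) (k : ℕ) where

  length≤*length-of-cover :
    ∀ (bs : List B) (xs : List A) → Unique xs →
    (∀ b {ys} → ys ⊆ xs → Unique ys → All (λ y → R y b) ys → length ys ≤ k) →
    All (λ x → Any (R x) bs) xs → length xs ≤ k * length bs
  length≤*length-of-cover [] []      _ _ _          = z≤n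
  length≤*length-of-cover [] (_ ∷ _) _ _ (() ∷ _)
  length≤*length-of-cover (b ∷ bs) xs xs! bound covered = begin
    length xs                      ≡⟨ length-filter-∁ inb xs ⟩
    length inside + length outside ≤⟨ +-mono-≤ inside≤k outside≤k*bs ⟩
    k + k * length bs              ≡⟨ sym (*-suc k (length bs)) ⟩
    k * length (b ∷ bs)            ∎
    where
    open ≤-Reasoning
    inb : Decidable (λ x → R x b)
    inb x = R? x b
    inside : List A
    inside = filter inb xs
    outside : List A
    outside = filter (∁? inb) xs
    bound′ : ∀ b′ {ys} → ys ⊆ outside → Unique ys → All (λ y → R y b′) ys → length ys ≤ k
    bound′ b′ ys⊆ = bound b′ (⊆-trans ys⊆ (filter-⊆ (∁? inb) xs))
    covered′ : All (λ x → Any (R x) bs) outside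
    covered′ = All.zipWith (λ (c , ¬r) → any-∷-∁ c ¬r)
                 (All-filter⁺ (∁? inb) covered , all-filter (∁? inb) xs)
    inside≤k : length inside ≤ k
    inside≤k = bound b (filter-⊆ inb xs) (Unique-filter⁺ inb xs!) (all-filter inb xs)
    outside≤k*bs : length outside ≤ k * length bs
    outside≤k*bs = length≤*length-of-cover bs outside (Unique-filter⁺ (∁? inb) xs!) bound′ covered′

module _ {n : ℕ} (G : Graph n) where

  onWalk? : (a b : Fin n) → ∀ {u v k} (p : Walk G u v k) → Dec (OnWalk G a b p)
  onWalk? a b [ _ ] = no λ ()
  onWalk? a b (_∷_ {u} {w} e p)
    with ((u ≟ a) ×-dec (w ≟ b)) ⊎-dec ((u ≟ b) ×-dec (w ≟ a)) | onWalk? a b p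
  ... | yes ends | _      = yes (here e p ends)
  ... | no _     | yes on = yes (there e p on)
  ... | no ¬ends | no ¬on = no λ { (here _ _ ends) → ¬ends ends ; (there _ _ on) → ¬on on }

  onGeodesic? : (e : Edge G) (P : Geodesic G) → Dec (OnGeodesic G e P)
  onGeodesic? (a , b) P = onWalk? a b (Geodesic.walk P)

  edgeGP-length-on-geodesic≤2 :
    ∀ {S} → IsEdgeGPSet G S → (P : Geodesic G) → ∀ {ys} → ys ⊆ S → Unique ys →
    All (λ e → OnGeodesic G e P) ys → length ys ≤ 2
  edgeGP-length-on-geodesic≤2 _ _ {[]}              _ _ _ = z≤n
  edgeGP-length-on-geodesic≤2 _ _ {_ ∷ []}          _ _ _ = s≤s z≤n
  edgeGP-length-on-geodesic≤2 _ _ {_ ∷ _ ∷ []}      _ _ _ = s≤s (s≤s z≤n)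
  edgeGP-length-on-geodesic≤2 (_ , noThree) P {e₁ ∷ e₂ ∷ e₃ ∷ _} ys⊆S
    ((e₁≢e₂ ∷ e₁≢e₃ ∷ _) ∷ (e₂≢e₃ ∷ _) ∷ _) (on₁ ∷ on₂ ∷ on₃ ∷ _) =
    ⊥-elim (noThree P e₁ e₂ e₃ (ys⊆S (here refl)) (ys⊆S (there (here refl)))
             (ys⊆S (there (there (here refl)))) e₁≢e₂ e₁≢e₃ e₂≢e₃ (on₁ , on₂ , on₃))

lemma2p2 : ∀ {n : ℕ} (G : Graph n) → Connected G →
    ∀ (S : List (Edge G)) (𝒫 : List (Geodesic G)) →
    IsEdgeGPSet G S → IsIsoPathEdgeCover G 𝒫 →
    length S ≤ 2 * length 𝒫
lemma2p2 G _ S 𝒫 gp@((edges , S!) , _) cover =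
  length≤*length-of-cover (OnGeodesic G) (onGeodesic? G) 2 𝒫 S S!
    (λ P → edgeGP-length-on-geodesic≤2 G gp P)
    (All.map (cover _) edges)
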